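{- (i) The inclusion $\mathbb Q\langle v_0,v_1\rangle\hookrightarrow\mathbb Q\langle V\rangle$ is an embedding of Hopf algebras $(\mathbb Q\langle v_0,v_1\rangle,\circledast_I,\Delta)\hookrightarrow(\mathbb Q\langle V\rangle,\circledast_a,\Delta)$. (ii) The canonical projection $\mathbb Q\langle V\rangle\to\mathbb Q\langle v_0,v_1\rangle$ (sending words containing a letter $v_i$, $i\ge2$, to $0$ and fixing the other words) induces a surjective Hopf algebra morphism $(\mathbb Q\langle V\rangle,⧢,\Delta_a)\twoheadrightarrow(\mathbb Q\langle v_0,v_1\rangle,⧢,\Delta_I)$.
   Context: $V=\{v_0,v_1,\dots\}$ with weight $\mathrm{wt}(v_0)=1$, $\mathrm{wt}(v_i)=i$. For a set $X$ of letters, $\mathbb Q\langle X\rangle=U(\mathrm{Lie}(X))$ with concatenation, shuffle coproduct $\Delta$ (letters primitive, Sweedler notation) and shuffle product $⧢$; the pairing makes words orthonormal. Any post-Lie product $\triangleright$ on $\mathrm{Lie}(X)$ is extended to $\mathbb Q\langle X\rangle^{\otimes2}$ by $x\triangleright\mathbf1=0$, $\mathbf1\triangleright A=A$, $xA\triangleright y=x\triangleright(A\triangleright y)-(x\triangleright A)\triangleright y$, $A\triangleright BC=(A_{(1)}\triangleright B)(A_{(2)}\triangleright C)$, giving the Grossman–Larson product $A\circledast B=A_{(1)}(A_{(2)}\triangleright B)$ and its dual coproduct. Ihara case: on $\mathrm{Lie}(v_0,v_1)$, $a\triangleright_I$ is the derivation with $a\triangleright_Iv_0=0$ and $a\triangleright_Iv_1=[v_1,a]$;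 $\circledast_I,\Delta_I$ are the associated Grossman–Larson product and its dual. Ari case: ari multiplicity $\mathrm m_{\mathbf k,\mathbf l}=(-1)^{|\mathbf k|+|\mathbf l|}\prod_i\binom{k_i-1}{l_i-1}$ with $\binom{ -1}{ -1}=1$, $\binom{k-1}{ -1}=\binom{ -1}{l-1}=0$ for $k,l>0$; $\triangleright_a$ on $\mathrm{Lie}(V)$ is obtained from the free magma (product $\star$) by $t(\mathbf k)\triangleright_av_0=0$, $t(\mathbf k)\triangleright_av_s=\sum_{\mathbf l}\mathrm m_{\mathbf k,\mathbf l}v_{s+|\mathbf k|-|\mathbf l|}\star t(\mathbf l)$ ($s\ge1$) for a bracketing $t(\mathbf k)$ of $v_{k_1},\dots,v_{k_r}$, extended linearly in $t$, as a derivation in the second argument, and descended via $a\star b\mapsto[a,b]$; $\circledast_a,\Delta_a$ are the associated Grossman–Larson product and its dual coproduct. -}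

module Defs where

open import Data.Nat using (ℕ; zero; suc; _+_; _∸_; _≤_; _≤?_)
open import Data.Nat.Combinatorics using (_C_)
open import Data.Integer using (+_)
open import Data.Rational using (ℚ; 0ℚ; 1ℚ; _/_; -_) renaming (_+_ to _+ℚ_; _*_ to _*ℚ_)
open import Data.List using (List; []; _∷_; _++_; map; concatMap; upTo; length)
open import Data.List.Properties using (≡-dec)
open import Data.List.Relation.Unary.All using (All; all?)
open import Data.Product using (_×_; _,_)
open import Data.Bool using (if_then_else_)
open import Relation.Nullary using (does)
import Data.Nat as N

-- Letters v_i are coded by i : ℕ.  Words = List ℕ (basis of ℚ⟨V⟩).
-- ℚ⟨v0,v1⟩ is spanned by the "binary" words (all letters ≤ 1).

Word : Set
Word = List ℕ

Binary : Word → Set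
Binary w = All (λ i → i ≤ 1) w

-- finite formal ℚ-linear combinations (elements of the free vector space on A)
Lin : Set → Set
Lin A = List (ℚ × A)

ret : {A : Set} → A → Lin A
ret a = (1ℚ , a) ∷ []

neg : {A : Set} → Lin A → Lin A
neg = map (λ { (q , a) → (- q , a) })

bind : {A B : Set} → (A → Lin B) → Lin A → Lin B
bind f [] = []
bind f ((q , a) ∷ p) = map (λ { (r , b) → (q *ℚ r , b) }) (f a) ++ bind f p

bil : {A B C : Set} → (A → B → C) → Lin A → Lin B → Lin C
bil f p q = bind (λ a → bind (λ b → ret (f a b)) q) p

coeff : Word → Lin Word → ℚ
coeff w [] = 0ℚ
coeff w ((q , u) ∷ p) = (if does (≡-dec N._≟_ u w) then q else 0ℚ) +ℚ coeff w p

pair : Lin Word → Lin Word → ℚ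
pair [] q = 0ℚ
pair ((a , w) ∷ p) q = (a *ℚ coeff w q) +ℚ pair p q

shw : Word → Word → Lin Word
shw [] v = ret v
shw (a ∷ u) [] = ret (a ∷ u)
shw (a ∷ u) (b ∷ v) =
  map (λ { (q , w) → (q , a ∷ w) }) (shw u (b ∷ v)) ++
  map (λ { (q , w) → (q , b ∷ w) }) (shw (a ∷ u) v)

shuffle : Lin Word → Lin Word → Lin Word
shuffle p q = bind (λ u → bind (λ v → shw u v) q) p

-- Free magma on V (product ⋆); Lie elements are represented by
-- ℚ-combinations of magma elements, descended via a ⋆ b ↦ [a,b].

infixl 6 _⋆_
data Tree : Set where
  leaf : ℕ → Tree
  _⋆_  : Tree → Tree → Tree

concatL : Lin Word → Lin Word → Lin Word
concatL = bil _++_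

expT : Tree → Lin Word
expT (leaf i) = ret (i ∷ [])
expT (s ⋆ t) = concatL (expT s) (expT t) ++ neg (concatL (expT t) (expT s))

-- elements of U(Lie(V)) are represented by words of magma elements
Seq : Set
Seq = List Tree

expS : Seq → Lin Word
expS [] = ret []
expS (t ∷ A) = concatL (expT t) (expS A)

-- Generic extension of a post-Lie product to U ⊗ U and the
-- Grossman–Larson product, given  t ▷ b  for magma elements t, b.

module GL (lt : Tree → Tree → Lin Tree) where

  -- x ▷ A for x a Lie (magma) element: derivation of the product
  ltSeq : Tree → Seq → Lin Seq
  ltSeq x [] = []
  ltSeq x (b ∷ C) =
    map (λ { (q , t) → (q , t ∷ C) }) (lt x b) ++
    map (λ { (q , D) → (q , b ∷ D) }) (ltSeq x C)

  -- shuffle coproduct on U (Lie generators primitive), Sweedler terms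
  cop : Seq → List (Seq × Seq)
  cop [] = ([] , []) ∷ []
  cop (x ∷ A) = concatMap (λ { (B , C) → (x ∷ B , C) ∷ (B , x ∷ C) ∷ [] }) (cop A)

  -- A ▷ b for a Lie element b:  1 ▷ b = b,  xA ▷ b = x ▷ (A ▷ b) − (x ▷ A) ▷ b.
  -- The first argument (fuel) is the length of A (x ▷ A preserves length).
  actT' : ℕ → Seq → Tree → Lin Tree
  actT' _ [] b = ret b
  actT' zero (x ∷ A) b = []
  actT' (suc n) (x ∷ A) b =
    bind (lt x) (actT' n A b) ++ neg (bind (λ A' → actT' n A' b) (ltSeq x A))

  actT : Seq → Tree → Lin Tree
  actT A b = actT' (length A) A b

  eps : Seq → Lin Seq
  eps [] = ret []
  eps (_ ∷ _) = []

  act : Seq → Seq → Lin Seq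
  act A [] = eps A
  act A (b ∷ C) =
    concatMap (λ { (A₁ , A₂) → bil _∷_ (actT A₁ b) (act A₂ C) }) (cop A)

  glSeq : Seq → Seq → Lin Seq
  glSeq A B =
    concatMap (λ { (A₁ , A₂) → map (λ { (q , D) → (q , A₁ ++ D) }) (act A₂ B) }) (cop A)

  -- on words of ℚ⟨X⟩ (letters are Lie elements), expanded back into ℚ⟨X⟩
  glw : Word → Word → Lin Word
  glw u v = bind expS (glSeq (map leaf u) (map leaf v))

  dualCop : Lin Word → Word → Word → ℚ
  dualCop p u v = pair p (glw u v)

ltI : Tree → Tree → Lin Tree
ltI t (leaf zero) = []
ltI t (leaf (suc zero)) = ret (leaf 1 ⋆ t)
ltI t (leaf (suc (suc _))) = []   -- letters v_i, i ≥ 2, are not in ℚ⟨v0,v1⟩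
ltI t (b ⋆ c) =
  map (λ { (q , d) → (q , d ⋆ c) }) (ltI t b) ++ map (λ { (q , d) → (q , b ⋆ d) }) (ltI t c)

-- binom(k-1, l-1) with binom(-1,-1)=1, binom(k-1,-1)=binom(-1,l-1)=0 (k,l>0)
bin : ℕ → ℕ → ℚ
bin zero zero = 1ℚ
bin zero (suc _) = 0ℚ
bin (suc _) zero = 0ℚ
bin (suc k) (suc l) = (+ (k C l)) / 1

sgn : ℕ → ℚ
sgn zero = 1ℚ
sgn (suc n) = - sgn n

size : Tree → ℕ
size (leaf k) = k
size (s ⋆ t) = size s + size t

binProd : Tree → Tree → ℚ
binProd (leaf k) (leaf l) = bin k l
binProd (s ⋆ t) (s' ⋆ t') = binProd s s' *ℚ binProd t t'
binProd _ _ = 0ℚ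

mult : Tree → Tree → ℚ
mult t u = sgn (size t + size u) *ℚ binProd t u

-- all bracketings t(l) of the same shape as t(k) with 0 ≤ lᵢ ≤ kᵢ
-- (for lᵢ > kᵢ the multiplicity vanishes, so the sum over l is finite)
relabels : Tree → List Tree
relabels (leaf k) = map leaf (upTo (suc k))
relabels (s ⋆ t) = concatMap (λ s' → map (λ t' → s' ⋆ t') (relabels t)) (relabels s)

ltA : Tree → Tree → Lin Tree
ltA t (leaf zero) = []
ltA t (leaf (suc s)) =
  map (λ u → (mult t u , leaf (suc s + size t ∸ size u) ⋆ u)) (relabels t)
ltA t (b ⋆ c) =
  map (λ { (q , d) → (q , d ⋆ c) }) (ltA t b) ++ map (λ { (q , d) → (q , b ⋆ d) }) (ltA t c)

module GLI = GL ltI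
module GLA = GL ltA

glI : Word → Word → Lin Word
glI = GLI.glw

glA : Word → Word → Lin Word
glA = GLA.glw

ΔI : Lin Word → Word → Word → ℚ
ΔI = GLI.dualCop

Δa : Lin Word → Word → Word → ℚ
Δa = GLA.dualCop

proj : Lin Word → Lin Word
proj = bind (λ w → if does (all? (λ i → i ≤? 1) w) then ret w else [])

-- On words in v₀, v₁ the ari action collapses to the Ihara action: for a bracketing t(k) with
-- every kᵢ ∈ {0,1} the ari multiplicity m_{k,l} is the Kronecker delta δ_{k,l}, so
-- t ▷_a v₁ = [v₁, t] = t ▷_I v₁, while both actions kill v₀.  Everything in the Grossman–Larson
-- construction is built from ▷ alone and the Ihara operations never create a letter v_i with
-- i ≥ 2, so ⊛_a and ⊛_I agree on ℚ⟨v₀,v₁⟩.  Dually ⟨Δ_a p, u ⊗ v⟩ = ⟨p, u ⊛_I v⟩ only sees the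
-- binary part of p, and the projection respects ⧢ because a shuffle of two words is binary
-- exactly when both words are.

module Submission where

open import Defs
open import Data.Product using (_×_; ∃; proj₂; _,_; proj₁; map₂)
open import Relation.Binary.PropositionalEquality using (_≡_)
open import Data.List.Relation.Unary.All using (All)

open import Algebra.Bundles using (CommutativeMonoid)
import Algebra.Properties.CommutativeSemigroup as CommutativeSemigroupProperties
open import Data.Bool using (Bool; true; false; if_then_else_; _∧_)
open import Data.Bool.Properties using (∧-assoc; ∧-identityʳ; ∧-commutativeMonoid)
open import Data.Empty using (⊥-elim)
open import Data.List using (List; []; _∷_; _++_; map; concatMap)
open import Data.List.Properties using (≡-dec)
open import Data.List.Relation.Unary.All using ([]; _∷_; all?)
import Data.List.Relation.Unary.All as All
open import Data.List.Relation.Unary.All.Properties using (++⁺; map⁺; concat⁺)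
open import Data.Nat as ℕ using (ℕ; zero; suc; _≤_; _≤?_; z≤n; s≤s)
import Data.Nat.Properties as ℕₚ
open import Data.Rational using (ℚ; 0ℚ; 1ℚ; _+_; _*_; -_)
open import Data.Rational.Properties
  using (+-assoc; +-identityˡ; +-identityʳ; *-assoc; *-identityˡ; *-identityʳ; *-zeroˡ; *-zeroʳ;
         *-distribˡ-+; neg-distrib-+; neg-distribˡ-*; *-1-commutativeMonoid)
open import Function using (_∘_)
open import Relation.Binary.PropositionalEquality using (refl; sym; trans; cong; cong₂; module ≡-Reasoning)
open import Relation.Nullary using (¬_; does; yes; no)
open import Relation.Nullary.Decidable using (dec-true)

private
  variable
    A B C : Set

-- Finite sums and linear combinations

∑ : List A → (A → ℚ) → ℚ
∑ []       f = 0ℚ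
∑ (x ∷ xs) f = f x + ∑ xs f

∑-++ : ∀ (xs ys : List A) f → ∑ (xs ++ ys) f ≡ ∑ xs f + ∑ ys f
∑-++ []       ys f = sym (+-identityˡ (∑ ys f))
∑-++ (x ∷ xs) ys f = trans (cong (f x +_) (∑-++ xs ys f)) (sym (+-assoc (f x) (∑ xs f) (∑ ys f)))

∑-map : ∀ (h : A → B) xs f → ∑ (map h xs) f ≡ ∑ xs (f ∘ h)
∑-map h []       f = refl
∑-map h (x ∷ xs) f = cong (f (h x) +_) (∑-map h xs f)

∑-concatMap : ∀ (h : A → List B) xs f → ∑ (concatMap h xs) f ≡ ∑ xs (λ x → ∑ (h x) f)
∑-concatMap h []       f = refl
∑-concatMap h (x ∷ xs) f = trans (∑-++ (h x) (concatMap h xs) f) (cong (∑ (h x) f +_) (∑-concatMap h xs f))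

∑-cong : ∀ (xs : List A) {f g} → (∀ x → f x ≡ g x) → ∑ xs f ≡ ∑ xs g
∑-cong []       f≗g = refl
∑-cong (x ∷ xs) f≗g = cong₂ _+_ (f≗g x) (∑-cong xs f≗g)

∑-cong-on : ∀ {P : A → Set} {xs f g} → All P xs → (∀ {x} → P x → f x ≡ g x) → ∑ xs f ≡ ∑ xs g
∑-cong-on []         f≗g = refl
∑-cong-on (px ∷ pxs) f≗g = cong₂ _+_ (f≗g px) (∑-cong-on pxs f≗g)

∑-*ˡ : ∀ c (xs : List A) f → ∑ xs (λ x → c * f x) ≡ c * ∑ xs f
∑-*ˡ c []       f = sym (*-zeroʳ c)
∑-*ˡ c (x ∷ xs) f = trans (cong (c * f x +_) (∑-*ˡ c xs f)) (sym (*-distribˡ-+ c (f x) (∑ xs f)))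

∑-neg : ∀ (xs : List A) f → ∑ xs (λ x → - f x) ≡ - ∑ xs f
∑-neg []       f = refl
∑-neg (x ∷ xs) f = trans (cong (- f x +_) (∑-neg xs f)) (sym (neg-distrib-+ (f x) (∑ xs f)))

∑-zero : ∀ (xs : List A) → ∑ xs (λ _ → 0ℚ) ≡ 0ℚ
∑-zero []       = refl
∑-zero (x ∷ xs) = trans (+-identityˡ (∑ xs (λ _ → 0ℚ))) (∑-zero xs)

⟦_⟧ : Lin A → (A → ℚ) → ℚ
⟦ p ⟧ g = ∑ p (λ x → proj₁ x * g (proj₂ x))

Sup : (A → Set) → Lin A → Set
Sup P = All (P ∘ proj₂)

⟦⟧-cong : ∀ (p : Lin A) {g g′} → (∀ a → g a ≡ g′ a) → ⟦ p ⟧ g ≡ ⟦ p ⟧ g′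
⟦⟧-cong p g≗g′ = ∑-cong p (λ x → cong (proj₁ x *_) (g≗g′ (proj₂ x)))

⟦⟧-cong-on : ∀ {P : A → Set} {p g g′} → Sup P p → (∀ {a} → P a → g a ≡ g′ a) → ⟦ p ⟧ g ≡ ⟦ p ⟧ g′
⟦⟧-cong-on sp g≗g′ = ∑-cong-on sp (λ {x} pa → cong (proj₁ x *_) (g≗g′ pa))

⟦⟧-zero : ∀ (p : Lin A) → ⟦ p ⟧ (λ _ → 0ℚ) ≡ 0ℚ
⟦⟧-zero p = trans (∑-cong p (λ x → *-zeroʳ (proj₁ x))) (∑-zero p)

⟦⟧-if : ∀ b (p : Lin A) f → ⟦ p ⟧ (λ a → if b then f a else 0ℚ) ≡ (if b then ⟦ p ⟧ f else 0ℚ)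
⟦⟧-if true  p f = refl
⟦⟧-if false p f = ⟦⟧-zero p

⟦ret⟧ : ∀ (a : A) g → ⟦ ret a ⟧ g ≡ g a
⟦ret⟧ a g = trans (+-identityʳ (1ℚ * g a)) (*-identityˡ (g a))

⟦++⟧ : ∀ (p q : Lin A) g → ⟦ p ++ q ⟧ g ≡ ⟦ p ⟧ g + ⟦ q ⟧ g
⟦++⟧ p q g = ∑-++ p q _

⟦neg⟧ : ∀ (p : Lin A) g → ⟦ neg p ⟧ g ≡ - ⟦ p ⟧ g
⟦neg⟧ p g = begin
  ⟦ neg p ⟧ g                           ≡⟨ ∑-map _ p _ ⟩
  ∑ p (λ x → - proj₁ x * g (proj₂ x))   ≡⟨ ∑-cong p (λ x → sym (neg-distribˡ-* (proj₁ x) (g (proj₂ x)))) ⟩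
  ∑ p (λ x → - (proj₁ x * g (proj₂ x))) ≡⟨ ∑-neg p _ ⟩
  - ⟦ p ⟧ g                             ∎
  where open ≡-Reasoning

⟦map₂⟧ : ∀ (F : A → B) p g → ⟦ map (map₂ F) p ⟧ g ≡ ⟦ p ⟧ (g ∘ F)
⟦map₂⟧ F p g = ∑-map (map₂ F) p _

⟦scale⟧ : ∀ c (p : Lin A) g → ⟦ map (λ x → (c * proj₁ x , proj₂ x)) p ⟧ g ≡ c * ⟦ p ⟧ g
⟦scale⟧ c p g = begin
  ⟦ map (λ x → (c * proj₁ x , proj₂ x)) p ⟧ g ≡⟨ ∑-map _ p _ ⟩
  ∑ p (λ x → c * proj₁ x * g (proj₂ x))       ≡⟨ ∑-cong p (λ x → *-assoc c (proj₁ x) (g (proj₂ x))) ⟩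
  ∑ p (λ x → c * (proj₁ x * g (proj₂ x)))     ≡⟨ ∑-*ˡ c p _ ⟩
  c * ⟦ p ⟧ g                                  ∎
  where open ≡-Reasoning

⟦bind⟧ : ∀ (f : A → Lin B) p g → ⟦ bind f p ⟧ g ≡ ⟦ p ⟧ (λ a → ⟦ f a ⟧ g)
⟦bind⟧ f []            g = refl
⟦bind⟧ f ((c , a) ∷ p) g =
  trans (⟦++⟧ (map (λ x → (c * proj₁ x , proj₂ x)) (f a)) (bind f p) g)
        (cong₂ _+_ (⟦scale⟧ c (f a) g) (⟦bind⟧ f p g))

⟦bil⟧ : ∀ (f : A → B → C) p q g → ⟦ bil f p q ⟧ g ≡ ⟦ p ⟧ (λ a → ⟦ q ⟧ (λ b → g (f a b)))
⟦bil⟧ f p q g = trans (⟦bind⟧ _ p g) (⟦⟧-cong p (λ a →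
                  trans (⟦bind⟧ _ q g) (⟦⟧-cong q (λ b → ⟦ret⟧ (f a b) g))))

-- A linear combination may list a basis element several times; two of them denote the same
-- vector iff every functional takes the same value on them.
infix 4 _≈_
record _≈_ (p q : Lin A) : Set where
  constructor mk≈
  field ⟦⟧-≡ : ∀ g → ⟦ p ⟧ g ≡ ⟦ q ⟧ g
open _≈_

≈-refl : {p : Lin A} → p ≈ p
≈-refl = mk≈ (λ g → refl)

≈-reflexive : {p q : Lin A} → p ≡ q → p ≈ q
≈-reflexive refl = ≈-refl

≈-trans : {p q r : Lin A} → p ≈ q → q ≈ r → p ≈ r
≈-trans p≈q q≈r = mk≈ (λ g → trans (⟦⟧-≡ p≈q g) (⟦⟧-≡ q≈r g))

++-cong : {p p′ q q′ : Lin A} → p ≈ p′ → q ≈ q′ → p ++ q ≈ p′ ++ q′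
++-cong {p = p} {p′} {q} {q′} p≈p′ q≈q′ = mk≈ λ g →
  trans (⟦++⟧ p q g) (trans (cong₂ _+_ (⟦⟧-≡ p≈p′ g) (⟦⟧-≡ q≈q′ g)) (sym (⟦++⟧ p′ q′ g)))

neg-cong : {p p′ : Lin A} → p ≈ p′ → neg p ≈ neg p′
neg-cong {p = p} {p′} p≈p′ = mk≈ λ g →
  trans (⟦neg⟧ p g) (trans (cong -_ (⟦⟧-≡ p≈p′ g)) (sym (⟦neg⟧ p′ g)))

map₂-cong : ∀ {F : A → B} {p p′} → p ≈ p′ → map (map₂ F) p ≈ map (map₂ F) p′
map₂-cong {F = F} {p} {p′} p≈p′ = mk≈ λ g →
  trans (⟦map₂⟧ F p g) (trans (⟦⟧-≡ p≈p′ (g ∘ F)) (sym (⟦map₂⟧ F p′ g)))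

bind-cong : ∀ {P : A → Set} {f f′ : A → Lin B} {p p′} →
            p ≈ p′ → Sup P p′ → (∀ {a} → P a → f a ≈ f′ a) → bind f p ≈ bind f′ p′
bind-cong {f = f} {f′} {p} {p′} p≈p′ sp′ f≈f′ = mk≈ λ g → begin
  ⟦ bind f p ⟧ g                  ≡⟨ ⟦bind⟧ f p g ⟩
  ⟦ p ⟧ (λ a → ⟦ f a ⟧ g)         ≡⟨ ⟦⟧-≡ p≈p′ _ ⟩
  ⟦ p′ ⟧ (λ a → ⟦ f a ⟧ g)        ≡⟨ ⟦⟧-cong-on sp′ (λ pa → ⟦⟧-≡ (f≈f′ pa) g) ⟩
  ⟦ p′ ⟧ (λ a → ⟦ f′ a ⟧ g)       ≡⟨ ⟦bind⟧ f′ p′ g ⟨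
  ⟦ bind f′ p′ ⟧ g                ∎
  where open ≡-Reasoning

bil-cong : ∀ {f : A → B → C} {p p′ q q′} → p ≈ p′ → q ≈ q′ → bil f p q ≈ bil f p′ q′
bil-cong {f = f} {p} {p′} {q} {q′} p≈p′ q≈q′ = mk≈ λ g → begin
  ⟦ bil f p q ⟧ g                               ≡⟨ ⟦bil⟧ f p q g ⟩
  ⟦ p ⟧ (λ a → ⟦ q ⟧ (λ b → g (f a b)))         ≡⟨ ⟦⟧-≡ p≈p′ _ ⟩
  ⟦ p′ ⟧ (λ a → ⟦ q ⟧ (λ b → g (f a b)))        ≡⟨ ⟦⟧-cong p′ (λ a → ⟦⟧-≡ q≈q′ _) ⟩
  ⟦ p′ ⟧ (λ a → ⟦ q′ ⟧ (λ b → g (f a b)))       ≡⟨ ⟦bil⟧ f p′ q′ g ⟨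
  ⟦ bil f p′ q′ ⟧ g                             ∎
  where open ≡-Reasoning

concatMap-cong : ∀ {R : A → Set} {f f′ : A → Lin B} {xs} →
                 All R xs → (∀ {x} → R x → f x ≈ f′ x) → concatMap f xs ≈ concatMap f′ xs
concatMap-cong []         f≈f′ = ≈-refl
concatMap-cong (rx ∷ rxs) f≈f′ = ++-cong (f≈f′ rx) (concatMap-cong rxs f≈f′)

concatMap⁺ : ∀ {R : A → Set} {Q : B → Set} {f : A → List B} {xs} →
             All R xs → (∀ {x} → R x → All Q (f x)) → All Q (concatMap f xs)
concatMap⁺ rxs k = concat⁺ (map⁺ (All.map k rxs))

map₂-sup : ∀ {P : A → Set} {Q : B → Set} {F : A → B} {p} →
           Sup P p → (∀ {a} → P a → Q (F a)) → Sup Q (map (map₂ F) p)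
map₂-sup sp k = map⁺ (All.map k sp)

neg-sup : ∀ {P : A → Set} {p} → Sup P p → Sup P (neg p)
neg-sup = map⁺

bind-sup : ∀ {P : A → Set} {Q : B → Set} {f : A → Lin B} {p} →
           Sup P p → (∀ {a} → P a → Sup Q (f a)) → Sup Q (bind f p)
bind-sup []         k = []
bind-sup (pa ∷ sp)  k = ++⁺ (map⁺ (k pa)) (bind-sup sp k)

bil-sup : ∀ {P : A → Set} {Q : B → Set} {R : C → Set} {f : A → B → C} {p q} →
          Sup P p → Sup Q q → (∀ {a b} → P a → Q b → R (f a b)) → Sup R (bil f p q)
bil-sup sp sq k = bind-sup sp (λ pa → bind-sup sq (λ qb → k pa qb ∷ []))

-- Ari versus Ihara actions

Leaves : (ℕ → Set) → Tree → Set
Leaves Q (leaf i) = Q i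
Leaves Q (s ⋆ t)  = Leaves Q s × Leaves Q t

BinaryTree : Tree → Set
BinaryTree = Leaves (_≤ 1)

expT-sup : ∀ {Q : ℕ → Set} t → Leaves Q t → Sup (All Q) (expT t)
expT-sup (leaf i) qi        = (qi ∷ []) ∷ []
expT-sup (s ⋆ t)  (qs , qt) =
  ++⁺ (bil-sup (expT-sup s qs) (expT-sup t qt) ++⁺)
      (neg-sup (bil-sup (expT-sup t qt) (expT-sup s qs) ++⁺))

expS-sup : ∀ {Q : ℕ → Set} {ts} → All (Leaves Q) ts → Sup (All Q) (expS ts)
expS-sup {ts = []}    []         = [] ∷ []
expS-sup {ts = t ∷ _} (qt ∷ qts) = bil-sup (expT-sup t qt) (expS-sup qts) ++⁺

sgn-+ : ∀ m n → sgn (m ℕ.+ n) ≡ sgn m * sgn n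
sgn-+ zero    n = sym (*-identityˡ (sgn n))
sgn-+ (suc m) n = trans (cong -_ (sgn-+ m n)) (neg-distribˡ-* (sgn m) (sgn n))

mult-⋆ : ∀ s t s′ t′ → mult (s ⋆ t) (s′ ⋆ t′) ≡ mult s s′ * mult t t′
mult-⋆ s t s′ t′ = begin
  sgn ((size s ℕ.+ size t) ℕ.+ (size s′ ℕ.+ size t′)) * (binProd s s′ * binProd t t′)
    ≡⟨ cong (λ n → sgn n * (binProd s s′ * binProd t t′)) (ℕ-interchange (size s) (size t) (size s′) (size t′)) ⟩
  sgn ((size s ℕ.+ size s′) ℕ.+ (size t ℕ.+ size t′)) * (binProd s s′ * binProd t t′)
    ≡⟨ cong (_* (binProd s s′ * binProd t t′)) (sgn-+ (size s ℕ.+ size s′) (size t ℕ.+ size t′)) ⟩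
  (sgn (size s ℕ.+ size s′) * sgn (size t ℕ.+ size t′)) * (binProd s s′ * binProd t t′)
    ≡⟨ ℚ-interchange (sgn (size s ℕ.+ size s′)) (sgn (size t ℕ.+ size t′)) (binProd s s′) (binProd t t′) ⟩
  mult s s′ * mult t t′ ∎
  where
  open ≡-Reasoning
  ℕ-interchange : ∀ a b c d → (a ℕ.+ b) ℕ.+ (c ℕ.+ d) ≡ (a ℕ.+ c) ℕ.+ (b ℕ.+ d)
  ℕ-interchange = CommutativeSemigroupProperties.interchange ℕₚ.+-commutativeSemigroup
  ℚ-interchange : ∀ a b c d → (a * b) * (c * d) ≡ (a * c) * (b * d)
  ℚ-interchange = CommutativeSemigroupProperties.interchange
                    (CommutativeMonoid.commutativeSemigroup *-1-commutativeMonoid)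

∑-mult-relabels : ∀ t → BinaryTree t → (h : Tree → ℚ) → ∑ (relabels t) (λ u → mult t u * h u) ≡ h t
∑-mult-relabels (leaf zero) _ h =
  trans (+-identityʳ (1ℚ * h (leaf 0))) (*-identityˡ (h (leaf 0)))
∑-mult-relabels (leaf (suc zero)) _ h = begin
  0ℚ * h (leaf 0) + (1ℚ * h (leaf 1) + 0ℚ) ≡⟨ cong₂ _+_ (*-zeroˡ (h (leaf 0))) (+-identityʳ (1ℚ * h (leaf 1))) ⟩
  0ℚ + 1ℚ * h (leaf 1)                     ≡⟨ +-identityˡ (1ℚ * h (leaf 1)) ⟩
  1ℚ * h (leaf 1)                          ≡⟨ *-identityˡ (h (leaf 1)) ⟩
  h (leaf 1)                               ∎
  where open ≡-Reasoning
∑-mult-relabels (leaf (suc (suc _))) (s≤s ()) h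
∑-mult-relabels (s ⋆ t) (bs , bt) h = begin
  ∑ (concatMap (λ s′ → map (s′ ⋆_) (relabels t)) (relabels s)) (λ u → mult (s ⋆ t) u * h u)
    ≡⟨ ∑-concatMap _ (relabels s) _ ⟩
  ∑ (relabels s) (λ s′ → ∑ (map (s′ ⋆_) (relabels t)) (λ u → mult (s ⋆ t) u * h u))
    ≡⟨ ∑-cong (relabels s) (λ s′ → ∑-map (s′ ⋆_) (relabels t) _) ⟩
  ∑ (relabels s) (λ s′ → ∑ (relabels t) (λ t′ → mult (s ⋆ t) (s′ ⋆ t′) * h (s′ ⋆ t′)))
    ≡⟨ ∑-cong (relabels s) (λ s′ → ∑-cong (relabels t) (λ t′ → split s′ t′)) ⟩
  ∑ (relabels s) (λ s′ → ∑ (relabels t) (λ t′ → mult s s′ * (mult t t′ * h (s′ ⋆ t′))))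
    ≡⟨ ∑-cong (relabels s) (λ s′ → ∑-*ˡ (mult s s′) (relabels t) _) ⟩
  ∑ (relabels s) (λ s′ → mult s s′ * ∑ (relabels t) (λ t′ → mult t t′ * h (s′ ⋆ t′)))
    ≡⟨ ∑-cong (relabels s) (λ s′ → cong (mult s s′ *_) (∑-mult-relabels t bt (λ t′ → h (s′ ⋆ t′)))) ⟩
  ∑ (relabels s) (λ s′ → mult s s′ * h (s′ ⋆ t))
    ≡⟨ ∑-mult-relabels s bs (λ s′ → h (s′ ⋆ t)) ⟩
  h (s ⋆ t) ∎
  where
  open ≡-Reasoning
  split : ∀ s′ t′ → mult (s ⋆ t) (s′ ⋆ t′) * h (s′ ⋆ t′) ≡ mult s s′ * (mult t t′ * h (s′ ⋆ t′))
  split s′ t′ = trans (cong (_* h (s′ ⋆ t′)) (mult-⋆ s t s′ t′)) (*-assoc (mult s s′) (mult t t′) (h (s′ ⋆ t′)))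

ltA-v₁ : ∀ {x} → BinaryTree x → ltA x (leaf 1) ≈ ret (leaf 1 ⋆ x)
ltA-v₁ {x} bx = mk≈ λ g → begin
  ⟦ ltA x (leaf 1) ⟧ g
    ≡⟨ ∑-map _ (relabels x) _ ⟩
  ∑ (relabels x) (λ u → mult x u * g (leaf (1 ℕ.+ size x ℕ.∸ size u) ⋆ u))
    ≡⟨ ∑-mult-relabels x bx _ ⟩
  g (leaf (1 ℕ.+ size x ℕ.∸ size x) ⋆ x)
    ≡⟨ cong (λ n → g (leaf n ⋆ x)) (ℕₚ.m+n∸n≡m 1 (size x)) ⟩
  g (leaf 1 ⋆ x)
    ≡⟨ ⟦ret⟧ (leaf 1 ⋆ x) g ⟨
  ⟦ ret (leaf 1 ⋆ x) ⟧ g ∎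
  where open ≡-Reasoning

ltA≈ltI : ∀ x b → BinaryTree x → BinaryTree b → ltA x b ≈ ltI x b
ltA≈ltI x (leaf zero)          _  _         = ≈-refl
ltA≈ltI x (leaf (suc zero))    bx _         = ltA-v₁ bx
ltA≈ltI x (leaf (suc (suc _))) _  (s≤s ())
ltA≈ltI x (b ⋆ c)              bx (bb , bc) =
  ++-cong (map₂-cong (ltA≈ltI x b bx bb)) (map₂-cong (ltA≈ltI x c bx bc))

ltI-binary : ∀ x b → BinaryTree x → BinaryTree b → Sup BinaryTree (ltI x b)
ltI-binary x (leaf zero)          _  _         = []
ltI-binary x (leaf (suc zero))    bx _         = (s≤s z≤n , bx) ∷ []
ltI-binary x (leaf (suc (suc _))) _  (s≤s ())
ltI-binary x (b ⋆ c)              bx (bb , bc) =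
  ++⁺ (map₂-sup (ltI-binary x b bx bb) (_, bc)) (map₂-sup (ltI-binary x c bx bc) (bb ,_))

-- Grossman–Larson products of two agreeing post-Lie products

module GL-Closure (lt : Tree → Tree → Lin Tree) (P : Tree → Set)
                  (lt-closed : ∀ x b → P x → P b → Sup P (lt x b)) where
  open GL lt

  ltSeq-closed : ∀ x {A} → P x → All P A → Sup (All P) (ltSeq x A)
  ltSeq-closed x px []              = []
  ltSeq-closed x px (_∷_ {b} pb pC) =
    ++⁺ (map₂-sup (lt-closed x b px pb) (_∷ pC)) (map₂-sup (ltSeq-closed x px pC) (pb ∷_))

  actT′-closed : ∀ n {A b} → All P A → P b → Sup P (actT' n A b)
  actT′-closed n       []              pb = pb ∷ []
  actT′-closed zero    (_ ∷ _)         pb = []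
  actT′-closed (suc n) (_∷_ {x} px pA) pb =
    ++⁺ (bind-sup (actT′-closed n pA pb) (λ {c} pc → lt-closed x c px pc))
        (neg-sup (bind-sup (ltSeq-closed x px pA) (λ pA′ → actT′-closed n pA′ pb)))

  cop-closed : ∀ {A} → All P A → All (λ e → All P (proj₁ e) × All P (proj₂ e)) (cop A)
  cop-closed []        = ([] , []) ∷ []
  cop-closed (px ∷ pA) =
    concatMap⁺ (cop-closed pA) (λ { (pB , pC) → (px ∷ pB , pC) ∷ (pB , px ∷ pC) ∷ [] })

  act-closed : ∀ {A B} → All P A → All P B → Sup (All P) (act A B)
  act-closed []      []        = [] ∷ []
  act-closed (_ ∷ _) []        = []
  act-closed pA      (pb ∷ pC) =
    concatMap⁺ (cop-closed pA) (λ { (pA₁ , pA₂) → bil-sup (actT′-closed _ pA₁ pb) (act-closed pA₂ pC) _∷_ })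

  glSeq-closed : ∀ {A B} → All P A → All P B → Sup (All P) (glSeq A B)
  glSeq-closed pA pB =
    concatMap⁺ (cop-closed pA) (λ { (pA₁ , pA₂) → map₂-sup (act-closed pA₂ pB) (++⁺ pA₁) })

module GL-Agreement (lt lt′ : Tree → Tree → Lin Tree) (P : Tree → Set)
                    (lt′-closed : ∀ x b → P x → P b → Sup P (lt′ x b))
                    (lt≈lt′ : ∀ x b → P x → P b → lt x b ≈ lt′ x b) where
  private
    module G  = GL lt
    module G′ = GL lt′
  open GL-Closure lt′ P lt′-closed

  -- cop ignores the post-Lie product, yet the two instances only agree on each concrete A.
  cop-≡ : ∀ A → G.cop A ≡ G′.cop A
  cop-≡ []      = refl
  cop-≡ (x ∷ A) = cong (concatMap _) (cop-≡ A)

  ltSeq-≈ : ∀ x {A} → P x → All P A → G.ltSeq x A ≈ G′.ltSeq x A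
  ltSeq-≈ x px []              = ≈-refl
  ltSeq-≈ x px (_∷_ {b} pb pC) = ++-cong (map₂-cong (lt≈lt′ x b px pb)) (map₂-cong (ltSeq-≈ x px pC))

  actT′-≈ : ∀ n {A b} → All P A → P b → G.actT' n A b ≈ G′.actT' n A b
  actT′-≈ n       []              pb = ≈-refl
  actT′-≈ zero    (_ ∷ _)         pb = ≈-refl
  actT′-≈ (suc n) (_∷_ {x} px pA) pb =
    ++-cong (bind-cong (actT′-≈ n pA pb) (actT′-closed n pA pb) (λ {c} pc → lt≈lt′ x c px pc))
            (neg-cong (bind-cong (ltSeq-≈ x px pA) (ltSeq-closed x px pA) (λ pA′ → actT′-≈ n pA′ pb)))

  act-≈ : ∀ {A B} → All P A → All P B → G.act A B ≈ G′.act A B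
  act-≈ []      []        = ≈-refl
  act-≈ (_ ∷ _) []        = ≈-refl
  act-≈ {A} pA  (pb ∷ pC) =
    ≈-trans (≈-reflexive (cong (concatMap _) (cop-≡ A)))
            (concatMap-cong (cop-closed pA) (λ { (pA₁ , pA₂) → bil-cong (actT′-≈ _ pA₁ pb) (act-≈ pA₂ pC) }))

  glSeq-≈ : ∀ {A B} → All P A → All P B → G.glSeq A B ≈ G′.glSeq A B
  glSeq-≈ {A} pA pB =
    ≈-trans (≈-reflexive (cong (concatMap _) (cop-≡ A)))
            (concatMap-cong (cop-closed pA) (λ { (_ , pA₂) → map₂-cong (act-≈ pA₂ pB) }))

  glw-≈ : ∀ {u v} → All (P ∘ leaf) u → All (P ∘ leaf) v → G.glw u v ≈ G′.glw u v
  glw-≈ pu pv = bind-cong (glSeq-≈ (map⁺ pu) (map⁺ pv)) (glSeq-closed (map⁺ pu) (map⁺ pv)) (λ _ → ≈-refl)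

-- Coefficients, pairing and the projection onto ℚ⟨v₀,v₁⟩

δ : Word → Word → ℚ
δ w u = if does (≡-dec ℕ._≟_ u w) then 1ℚ else 0ℚ

coeff-⟦⟧ : ∀ w p → coeff w p ≡ ⟦ p ⟧ (δ w)
coeff-⟦⟧ w []            = refl
coeff-⟦⟧ w ((c , u) ∷ p) = cong₂ _+_ (if-scale (does (≡-dec ℕ._≟_ u w))) (coeff-⟦⟧ w p)
  where
  if-scale : ∀ b → (if b then c else 0ℚ) ≡ c * (if b then 1ℚ else 0ℚ)
  if-scale true  = sym (*-identityʳ c)
  if-scale false = sym (*-zeroʳ c)

coeff-≈ : ∀ {p q} → p ≈ q → ∀ w → coeff w p ≡ coeff w q
coeff-≈ {p} {q} p≈q w = trans (coeff-⟦⟧ w p) (trans (⟦⟧-≡ p≈q (δ w)) (sym (coeff-⟦⟧ w q)))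

coeff-outside : ∀ {P : Word → Set} {p w} → Sup P p → ¬ P w → coeff w p ≡ 0ℚ
coeff-outside                       []        ¬pw = refl
coeff-outside {p = (c , u) ∷ p} {w} (pu ∷ sp) ¬pw with ≡-dec ℕ._≟_ u w
... | yes refl = ⊥-elim (¬pw pu)
... | no  _    = trans (+-identityˡ (coeff w p)) (coeff-outside sp ¬pw)

pair-⟦⟧ : ∀ p q → pair p q ≡ ⟦ p ⟧ (λ w → coeff w q)
pair-⟦⟧ []            q = refl
pair-⟦⟧ ((c , w) ∷ p) q = cong (c * coeff w q +_) (pair-⟦⟧ p q)

pair-congʳ : ∀ p {q q′} → q ≈ q′ → pair p q ≡ pair p q′
pair-congʳ p {q} {q′} q≈q′ =
  trans (pair-⟦⟧ p q) (trans (⟦⟧-cong p (coeff-≈ q≈q′)) (sym (pair-⟦⟧ p q′)))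

isBinary : Word → Bool
isBinary w = does (all? (λ i → i ≤? 1) w)

binaryPart : (Word → ℚ) → Word → ℚ
binaryPart g w = if isBinary w then g w else 0ℚ

⟦proj⟧ : ∀ p g → ⟦ proj p ⟧ g ≡ ⟦ p ⟧ (binaryPart g)
⟦proj⟧ p g = trans (⟦bind⟧ _ p g) (⟦⟧-cong p (λ w → ⟦if-ret⟧ (isBinary w) w))
  where
  ⟦if-ret⟧ : ∀ b w → ⟦ if b then ret w else [] ⟧ g ≡ (if b then g w else 0ℚ)
  ⟦if-ret⟧ true  w = ⟦ret⟧ w g
  ⟦if-ret⟧ false w = refl

proj-id : ∀ {p} → Sup Binary p → proj p ≈ p
proj-id {p} bp = mk≈ λ g →
  trans (⟦proj⟧ p g) (⟦⟧-cong-on bp (λ {w} bw → cong (if_then g w else 0ℚ) (dec-true (all? _ w) bw)))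

binaryPart-coeff : ∀ {q} → Sup Binary q → ∀ w → binaryPart (λ w → coeff w q) w ≡ coeff w q
binaryPart-coeff bq w with all? (λ i → i ≤? 1) w
... | yes _  = refl
... | no ¬bw = sym (coeff-outside bq ¬bw)

pair-proj : ∀ p {q} → Sup Binary q → pair (proj p) q ≡ pair p q
pair-proj p {q} bq = begin
  pair (proj p) q                          ≡⟨ pair-⟦⟧ (proj p) q ⟩
  ⟦ proj p ⟧ (λ w → coeff w q)             ≡⟨ ⟦proj⟧ p _ ⟩
  ⟦ p ⟧ (binaryPart (λ w → coeff w q))     ≡⟨ ⟦⟧-cong p (binaryPart-coeff bq) ⟩
  ⟦ p ⟧ (λ w → coeff w q)                  ≡⟨ pair-⟦⟧ p q ⟨
  pair p q                                 ∎
  where open ≡-Reasoning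

shw-isBinary : ∀ u v → Sup (λ w → isBinary w ≡ isBinary u ∧ isBinary v) (shw u v)
shw-isBinary []      v       = refl ∷ []
shw-isBinary (a ∷ u) []      = sym (∧-identityʳ (isBinary (a ∷ u))) ∷ []
shw-isBinary (a ∷ u) (b ∷ v) =
  ++⁺ (map₂-sup (shw-isBinary u (b ∷ v))
         (λ e → trans (cong (does (a ≤? 1) ∧_) e) (sym (∧-assoc (does (a ≤? 1)) (isBinary u) (isBinary (b ∷ v))))))
      (map₂-sup (shw-isBinary (a ∷ u) v)
         (λ e → trans (cong (does (b ≤? 1) ∧_) e) (∧-swap (does (b ≤? 1)) (isBinary (a ∷ u)) (isBinary v))))
  where
  ∧-swap : ∀ x y z → x ∧ (y ∧ z) ≡ y ∧ (x ∧ z)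
  ∧-swap = CommutativeSemigroupProperties.x∙yz≈y∙xz (CommutativeMonoid.commutativeSemigroup ∧-commutativeMonoid)

⟦shw⟧-binaryPart : ∀ u v g → ⟦ shw u v ⟧ (binaryPart g) ≡ (if isBinary u ∧ isBinary v then ⟦ shw u v ⟧ g else 0ℚ)
⟦shw⟧-binaryPart u v g =
  trans (⟦⟧-cong-on (shw-isBinary u v) (λ {w} e → cong (if_then g w else 0ℚ) e))
        (⟦⟧-if (isBinary u ∧ isBinary v) (shw u v) g)

⟦shuffle⟧ : ∀ p q g → ⟦ shuffle p q ⟧ g ≡ ⟦ p ⟧ (λ u → ⟦ q ⟧ (λ v → ⟦ shw u v ⟧ g))
⟦shuffle⟧ p q g = trans (⟦bind⟧ _ p g) (⟦⟧-cong p (λ u → ⟦bind⟧ _ q g))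

proj-shuffle : ∀ p q → proj (shuffle p q) ≈ shuffle (proj p) (proj q)
proj-shuffle p q = mk≈ λ g → begin
  ⟦ proj (shuffle p q) ⟧ g
    ≡⟨ trans (⟦proj⟧ (shuffle p q) g) (⟦shuffle⟧ p q _) ⟩
  ⟦ p ⟧ (λ u → ⟦ q ⟧ (λ v → ⟦ shw u v ⟧ (binaryPart g)))
    ≡⟨ ⟦⟧-cong p (λ u → ⟦⟧-cong q (λ v → ⟦shw⟧-binaryPart u v g)) ⟩
  ⟦ p ⟧ (λ u → ⟦ q ⟧ (λ v → if isBinary u ∧ isBinary v then ⟦ shw u v ⟧ g else 0ℚ))
    ≡⟨ ⟦⟧-cong p (λ u → guard (isBinary u) (λ v → ⟦ shw u v ⟧ g)) ⟩
  ⟦ p ⟧ (binaryPart (λ u → ⟦ q ⟧ (binaryPart (λ v → ⟦ shw u v ⟧ g))))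
    ≡⟨ trans (⟦proj⟧ p _) (⟦⟧-cong p (λ u → cong (if isBinary u then_else 0ℚ) (⟦proj⟧ q _))) ⟨
  ⟦ proj p ⟧ (λ u → ⟦ proj q ⟧ (λ v → ⟦ shw u v ⟧ g))
    ≡⟨ ⟦shuffle⟧ (proj p) (proj q) g ⟨
  ⟦ shuffle (proj p) (proj q) ⟧ g ∎
  where
  open ≡-Reasoning
  guard : ∀ b f → ⟦ q ⟧ (λ v → if b ∧ isBinary v then f v else 0ℚ) ≡ (if b then ⟦ q ⟧ (binaryPart f) else 0ℚ)
  guard true  f = refl
  guard false f = ⟦⟧-zero q

glA≈glI : ∀ {u v} → Binary u → Binary v → glA u v ≈ glI u v
glA≈glI = GL-Agreement.glw-≈ ltA ltI BinaryTree ltI-binary ltA≈ltI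

glI-binary : ∀ {u v} → Binary u → Binary v → Sup Binary (glI u v)
glI-binary bu bv = bind-sup (glSeq-closed (map⁺ bu) (map⁺ bv)) expS-sup
  where open GL-Closure ltI BinaryTree ltI-binary

proposition4p33 :
    (∀ u v → Binary u → Binary v → ∀ w → coeff w (glA u v) ≡ coeff w (glI u v))
    ×
    ((∀ p q w → coeff w (proj (shuffle p q)) ≡ coeff w (shuffle (proj p) (proj q)))
     ×
     (∀ p u v → Binary u → Binary v → Δa p u v ≡ ΔI (proj p) u v)
     ×
     (∀ (p : Lin Word) → All (λ qw → Binary (proj₂ qw)) p →
        ∃ λ (q : Lin Word) → ∀ w → coeff w (proj q) ≡ coeff w p))
proposition4p33 =
    (λ u v bu bv → coeff-≈ (glA≈glI bu bv))
  , (λ p q → coeff-≈ (proj-shuffle p q))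
  , (λ p u v bu bv → trans (pair-congʳ p (glA≈glI bu bv)) (sym (pair-proj p (glI-binary bu bv))))
  , (λ p bp → p , coeff-≈ (proj-id bp))
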